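{- Let $c$, $\prec$ and $T'$ be as in the context. There exists a function $\beta\colon\mathbb{N}\to\mathbb{N}$ such that \[ \forall n\ \forall s\in\mathbb{B}^n\ \bigl(\exists k\,T'(s,k)\to T'(s,\beta n)\bigr). \]
   Context: $\mathbb{B}=\{0,1\}$; $c\colon\mathbb{N}^2\to\mathbb{B}$ with $c(i,j)=c(j,i)$. The Erdős–Rado order $\prec$: $0\prec1$, and, given $\prec$ already defined on $\{0,\dots,j\}$, for $j<i$ set $j\prec i$ iff $c(k,i)=c(k,j)$ for all $k\prec j$. For a finite binary sequence $s$ of length $|s|$ with entries $s_0,\dots,s_{|s|-1}$ and $k\in\mathbb{N}$: $T'(s,k):\equiv\exists k'\in[|s|,k]\ \forall i<|s|\,(s_i=0\leftrightarrow i\prec k')$. -}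

module Defs where

open import Data.Nat using (ℕ; zero; suc; _<_; _≤_)
open import Data.Bool using (Bool; true; false)
open import Data.Empty using (⊥)
open import Data.Product using (_×_; Σ; ∃)
open import Data.Fin using (Fin; toℕ)
open import Data.Vec using (Vec; lookup)
open import Relation.Binary.PropositionalEquality using (_≡_)

-- A 2-colouring of pairs of naturals; 𝔹 = {0,1} is rendered as Bool with
-- 0 = false, 1 = true.  Symmetry c i j ≡ c j i is a separate hypothesis.
Colouring : Set
Colouring = ℕ → ℕ → Bool

-- Erdős–Rado order, defined by course-of-values recursion on the smaller
-- element, made structural with a fuel parameter.
--   precFuel c f j i  : "j ≺ i", computed with recursion depth f.
-- j ≺ i  iff  j < i  and  for all k ≺ j : c k i ≡ c k j.
-- (k ≺ j forces k < j, so the quantifier ranges over k < j.)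
-- Fuel suc j suffices for deciding j ≺ i (each recursive call lowers the
-- smaller element strictly), so _≺_ below is the paper's order.
precFuel : Colouring → ℕ → ℕ → ℕ → Set
precFuel c zero    j i = ⊥
precFuel c (suc f) j i =
  j < i × (∀ k → k < j → precFuel c f k j → c k i ≡ c k j)

Prec : Colouring → ℕ → ℕ → Set
Prec c j i = precFuel c (suc j) j i

T′ : Colouring → {n : ℕ} → Vec Bool n → ℕ → Set
T′ c {n} s k =
  ∃ λ k′ → n ≤ k′ × k′ ≤ k ×
    (∀ (i : Fin n) → (lookup s i ≡ false → Prec c (toℕ i) k′)
                   × (Prec c (toℕ i) k′ → lookup s i ≡ false))

-- For fixed n there are only finitely many s ∈ 𝔹ⁿ, and T′(s, k) is upward
-- closed in k.  Choosing (classically) a witness k for every s that has one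
-- and taking the maximum over 𝔹ⁿ gives β n.
module Submission where

open import Defs
open import Level using (0ℓ)
open import Data.Nat using (ℕ; zero; suc; _≤_; _⊔_)
open import Data.Nat.Properties using (≤-refl; ≤-trans; m≤m⊔n; m≤n⊔m)
open import Data.Bool using (Bool; true; false)
open import Data.Vec using (Vec; []; _∷_)
open import Data.Product using (Σ; ∃; _,_; proj₁; proj₂)
open import Data.Empty using (⊥-elim)
open import Relation.Binary.PropositionalEquality using (_≡_)
open import Relation.Nullary using (yes; no)
open import Axiom.ExcludedMiddle using (ExcludedMiddle)

maxOverBoolVec : (n : ℕ) → (Vec Bool n → ℕ) → ℕ
maxOverBoolVec zero    f = f []
maxOverBoolVec (suc n) f =
  maxOverBoolVec n (λ v → f (true ∷ v)) ⊔ maxOverBoolVec n (λ v → f (false ∷ v))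

≤-maxOverBoolVec : (n : ℕ) (f : Vec Bool n → ℕ) (s : Vec Bool n) →
                   f s ≤ maxOverBoolVec n f
≤-maxOverBoolVec zero    f []          = ≤-refl
≤-maxOverBoolVec (suc n) f (true ∷ s)  =
  ≤-trans (≤-maxOverBoolVec n (λ v → f (true ∷ v)) s) (m≤m⊔n _ _)
≤-maxOverBoolVec (suc n) f (false ∷ s) =
  ≤-trans (≤-maxOverBoolVec n (λ v → f (false ∷ v)) s) (m≤n⊔m _ _)

T′-mono : (c : Colouring) {n : ℕ} (s : Vec Bool n) {k l : ℕ} →
          k ≤ l → T′ c s k → T′ c s l
T′-mono c s k≤l (k′ , n≤k′ , k′≤k , agree) = k′ , n≤k′ , ≤-trans k′≤k k≤l , agree

witnessIfAny : ExcludedMiddle 0ℓ → (P : ℕ → Set) → ∃ λ k → (∃ P → P k)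
witnessIfAny em P with em {∃ P}
... | yes (k , Pk) = k , λ _ → Pk
... | no  ¬∃P      = 0 , λ ∃P → ⊥-elim (¬∃P ∃P)

lemma2p4 : ExcludedMiddle 0ℓ →
    (c : Colouring) → (∀ i j → c i j ≡ c j i) →
    Σ (ℕ → ℕ) λ β →
      ∀ (n : ℕ) (s : Vec Bool n) → (∃ λ k → T′ c s k) → T′ c s (β n)
lemma2p4 em c _ = β , λ n s ∃k → T′-mono c s (≤-maxOverBoolVec n witness s) (chosen s ∃k)
  where
  witness : {n : ℕ} → Vec Bool n → ℕ
  witness s = proj₁ (witnessIfAny em (T′ c s))

  chosen : {n : ℕ} (s : Vec Bool n) → (∃ λ k → T′ c s k) → T′ c s (witness s)
  chosen s = proj₂ (witnessIfAny em (T′ c s))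

  β : ℕ → ℕ
  β n = maxOverBoolVec n witness
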